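{- Let $r,p,q,n$ be positive integers with $p,q$ dividing $r$, $pq$ dividing $rn$, and $n\geq 3$. Let $d_0=\mathrm{GCD}(p,q,n)$, let $j,k$ be integers, and let $z\in C(r,p,q,n)$ with $z^2=1$. (1) The map $\alpha_{j,k,z}:G(r,p,n)\to G(r,p,q,n)$ given by $\alpha_{j,k,z}(\pi,x)=z^{\ell(\pi)}c^{\frac{\Delta(x)}{d_0}k}(\pi,jx)$ (with $\Delta(x)$ represented by any integer and the right side read in $G(r,p,q,n)$) is a well-defined homomorphism whose kernel contains $C_q$. (2) The induced homomorphism $\alpha_{j,k,z}:G(r,p,q,n)\to G(r,p,q,n)$ is an automorphism if and only if $\mathrm{GCD}(j,r)=\mathrm{GCD}\big(\tfrac{n}{d_0}k+j,\tfrac{rn}{pq},\tfrac{r}{q}\big)=1$.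
   Context: Let $\zeta_r=\exp(2\pi\sqrt{ -1}/r)$, $\mathbb{Z}_r=\mathbb{Z}/r\mathbb{Z}$. $G(r,n)$ is the group of $n\times n$ complex matrices with exactly one nonzero entry in each row and column, each an $r$th root of unity; elements are written $(\pi,x)$, $\pi\in S_n$, $x\in(\mathbb{Z}_r)^n$, meaning the matrix whose $i$th column has $\zeta_r^{x_i}$ in row $\pi(i)$. Put $\Delta(x)=\Delta(\pi,x)=\sum_ix_i$. For $p\mid r$, $G(r,p,n)=\{g:\Delta(g)\in p\mathbb{Z}_r\}$. Let $c=\zeta_rI_n$; when $p,q\mid r$ and $pq\mid rn$, $C_q=\langle c^{r/q}\rangle$ is central of order $q$ in $G(r,p,n)$ and $G(r,p,q,n)=G(r,p,n)/C_q$. $C(r,p,q,n)$ is the subgroup of $G(r,p,q,n)$ of elements equal to $c^i$ for some integer $i$. $\ell(\pi)$ denotes the length of $\pi\in S_n$ (number of inversions, i.e. Coxeter length with respect to the simple transpositions $(i,i+1)$). -}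

module Defs where

open import Data.Nat as ℕ using (ℕ; zero; suc)
import Data.Nat.DivMod as NDM
import Data.Nat.GCD as NG
open import Data.Integer as ℤ using (ℤ; +_; _+_; _*_; _-_; 0ℤ)
import Data.Integer.DivMod as ZDM
open import Data.Integer.Divisibility using () renaming (_∣_ to _∣ℤ_)
open import Data.Fin as F using (Fin)
open import Data.Fin.Permutation using (Permutation′; _⟨$⟩ʳ_; _∘ₚ_; id)
open import Data.List using (List; map; foldr; allFin)
open import Data.Bool using (Bool; if_then_else_; _∧_)
open import Data.Product using (Σ; _×_; ∃)
open import Relation.Nullary.Decidable using (⌊_⌋)
open import Relation.Binary.PropositionalEquality using (_≡_)

-- Natural-number quotient (used only for exact divisions; m ÷ 0 = 0 by convention).
_÷_ : ℕ → ℕ → ℕ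
m ÷ zero = 0
m ÷ suc d = NDM._/_ m (suc d)

-- Integer quotient by a natural number (used only for exact divisions).
divBy : ℤ → ℕ → ℤ
divBy a zero = 0ℤ
divBy a (suc d) = ZDM._/_ a (+ suc d)

-- congruence modulo r in ℤ  (ℤ_r is represented by ℤ up to this relation)
_≡[_]_ : ℤ → ℕ → ℤ → Set
a ≡[ r ] b = (+ r) ∣ℤ (a - b)

sumℤ : List ℤ → ℤ
sumℤ = foldr _+_ 0ℤ

-- Representatives (π , x) of elements of G(r,n): π ∈ S_n, x : Fin n → ℤ (read mod r).
-- The matrix has ζ_r^{x_i} in row π(i) of column i.
record Elt (n : ℕ) : Set where
  constructor ⟨_,_⟩
  field
    perm : Permutation′ n
    vec  : Fin n → ℤ
open Elt public

Δ : ∀ {n} → Elt n → ℤ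
Δ {n} g = sumℤ (map (vec g) (allFin n))

-- matrix product: (σ,y)(π,x) = (σ∘π , x + y∘π)
_·_ : ∀ {n} → Elt n → Elt n → Elt n
⟨ σ , y ⟩ · ⟨ π , x ⟩ = ⟨ π ∘ₚ σ , (λ i → x i + y (π ⟨$⟩ʳ i)) ⟩

-- c^a = ζ_r^a I_n
cpow : ∀ {n} → ℤ → Elt n
cpow a = ⟨ id , (λ _ → a) ⟩

ε : ∀ {n} → Elt n
ε = cpow 0ℤ

-- membership in G(r,p,n)  (p ∣ r, so this is independent of representatives)
InG : ∀ {n} → (p : ℕ) → Elt n → Set
InG p g = (+ p) ∣ℤ Δ g

_≈[_]_ : ∀ {n} → Elt n → ℕ → Elt n → Set
g ≈[ r ] h = (∀ i → perm g ⟨$⟩ʳ i ≡ perm h ⟨$⟩ʳ i) × (∀ i → vec g i ≡[ r ] vec h i)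

-- equality in G(r,p,q,n) = G(r,p,n)/C_q, C_q = ⟨ c^{r/q} ⟩
_∼[_,_]_ : ∀ {n} → Elt n → ℕ → ℕ → Elt n → Set
g ∼[ r , q ] h = (∀ i → perm g ⟨$⟩ʳ i ≡ perm h ⟨$⟩ʳ i)
               × ∃ λ (m : ℤ) → ∀ i → vec h i ≡[ r ] (vec g i + (+ (r ÷ q)) * m)

len : ∀ {n} → Permutation′ n → ℕ
len {n} π = foldr ℕ._+_ 0 (map (λ a → foldr ℕ._+_ 0 (map (λ b →
  if ⌊ a F.<? b ⌋ ∧ ⌊ (π ⟨$⟩ʳ b) F.<? (π ⟨$⟩ʳ a) ⌋ then 1 else 0) (allFin n))) (allFin n))

d₀ : ℕ → ℕ → ℕ → ℕ
d₀ p q n = NG.gcd (NG.gcd p q) n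

-- α_{j,k,z}(π,x) = z^{ℓ(π)} c^{(Δ(x)/d₀) k} (π, jx), with z = c^i
α : (p q n : ℕ) → (j k i : ℤ) → Elt n → Elt n
α p q n j k i g = ⟨ perm g , (λ t → i * (+ len (perm g)) + divBy (Δ g) (d₀ p q n) * k + j * vec g t) ⟩

module Submission where

-- For g = (π, x) the map reads α(g) = (π, t ↦ s(g) + j x_t) with the shift s(g) = i ℓ(π) + (Δ(x)/d₀) k,
-- and C_q consists of the shifts by multiples of Q = r/q, so every claim is a computation with shifts.
-- Multiplicativity needs ℓ(πσ) ≡ ℓ(π) + ℓ(σ) (mod 2) and 2i ≡ 0 (mod Q), which is what z² = 1 says.
-- If α(g) = α(h) and j is invertible modulo r, all h_t − g_t are congruent to one e, and e·(n/d₀ k + j),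
-- e·rn/(pq) and e·Q are multiples of Q, so Q ∣ e once their gcd is 1. Conversely, Bézout coefficients
-- for the two gcd conditions give explicit preimages, and if either gcd exceeds 1 an explicit element
-- outside C_q has the same image as the identity.

open import Defs
open import Data.Nat as ℕ using (ℕ; _≤_)
open import Data.Nat.Divisibility using () renaming (_∣_ to _∣ℕ_)
open import Data.Fin using (Fin; zero; suc)
open import Data.Product using (∃; ∃₂; _×_; _,_)
open import Relation.Binary.PropositionalEquality

module Sums where

  open import Data.Nat using (zero; suc)
  open import Data.Integer using (ℤ; +_; _+_; _*_; _-_; -_; 0ℤ; 1ℤ)
  import Data.Integer.Properties as ℤP
  open import Data.Integer.Divisibility.Signed using (_∣_; divides; ∣m∣n⇒∣m+n)
  open import Data.Fin.Permutation using (Permutation′; _⟨$⟩ʳ_)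
  open import Data.List as List using (allFin; map)
  import Data.List.Properties as ListP
  open import Function using (_∘_)
  open import Algebra.Properties.CommutativeMonoid.Sum ℤP.+-0-commutativeMonoid public
    using (sum-syntax; sum-cong-≗; ∑-distrib-+; ∑-comm; ∑-permute)
  open import Algebra.Properties.Semiring.Sum ℤP.+-*-semiring using (*-distribˡ-sum)

  sumℤ-allFin : ∀ {n} (f : Fin n → ℤ) → sumℤ (map f (allFin n)) ≡ ∑[ t < n ] f t
  sumℤ-allFin f = trans (cong sumℤ (ListP.map-tabulate (λ t → t) f)) (sumℤ-tabulate f)
    where
    sumℤ-tabulate : ∀ {n} (f : Fin n → ℤ) → sumℤ (List.tabulate f) ≡ ∑[ t < n ] f t
    sumℤ-tabulate {zero}  f = refl
    sumℤ-tabulate {suc n} f = cong (_+_ (f zero)) (sumℤ-tabulate (f ∘ suc))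

  pos-sumℕ-allFin : ∀ {n} (f : Fin n → ℕ) →
    + (List.foldr ℕ._+_ 0 (map f (allFin n))) ≡ ∑[ t < n ] (+ f t)
  pos-sumℕ-allFin f =
    trans (cong (+_ ∘ List.foldr ℕ._+_ 0) (ListP.map-tabulate (λ t → t) f)) (pos-sumℕ-tabulate f)
    where
    pos-sumℕ-tabulate : ∀ {n} (f : Fin n → ℕ) →
      + (List.foldr ℕ._+_ 0 (List.tabulate f)) ≡ ∑[ t < n ] (+ f t)
    pos-sumℕ-tabulate {zero}  f = refl
    pos-sumℕ-tabulate {suc n} f =
      trans (ℤP.pos-+ (f zero) _) (cong (_+_ (+ f zero)) (pos-sumℕ-tabulate (f ∘ suc)))

  Δ≡∑ : ∀ {n} (g : Elt n) → Δ g ≡ ∑[ t < n ] vec g t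
  Δ≡∑ g = sumℤ-allFin (vec g)

  ∑-const : ∀ n (c : ℤ) → ∑[ t < n ] c ≡ + n * c
  ∑-const zero    c = sym (ℤP.*-zeroˡ c)
  ∑-const (suc n) c = trans (cong (_+_ c) (∑-const n c)) (sym (ℤP.suc-* (+ n) c))

  ∑-zero : ∀ n → ∑[ t < n ] 0ℤ ≡ 0ℤ
  ∑-zero n = trans (∑-const n 0ℤ) (ℤP.*-zeroʳ (+ n))

  ∑-affine : ∀ n (c a : ℤ) (f : Fin n → ℤ) → ∑[ t < n ] (c + a * f t) ≡ + n * c + a * ∑[ t < n ] f t
  ∑-affine n c a f = trans (∑-distrib-+ (λ _ → c) (λ t → a * f t))
                           (cong₂ _+_ (∑-const n c) (sym (*-distribˡ-sum a f)))

  ∑-distrib-- : ∀ {n} (f g : Fin n → ℤ) → ∑[ t < n ] (f t - g t) ≡ ∑[ t < n ] f t - ∑[ t < n ] g t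
  ∑-distrib-- {n} f g = begin
    ∑[ t < n ] (f t - g t)                    ≡⟨ sum-cong-≗ (λ t → cong (_+_ (f t)) (sym (ℤP.-1*i≡-i (g t)))) ⟩
    ∑[ t < n ] (f t + - 1ℤ * g t)             ≡⟨ ∑-distrib-+ f (λ t → - 1ℤ * g t) ⟩
    ∑[ t < n ] f t + ∑[ t < n ] (- 1ℤ * g t)  ≡⟨ cong (_+_ (∑[ t < n ] f t)) (sym (*-distribˡ-sum (- 1ℤ) g)) ⟩
    ∑[ t < n ] f t + - 1ℤ * ∑[ t < n ] g t    ≡⟨ cong (_+_ (∑[ t < n ] f t)) (ℤP.-1*i≡-i (∑[ t < n ] g t)) ⟩
    ∑[ t < n ] f t - ∑[ t < n ] g t           ∎
    where open ≡-Reasoning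

  _∣0 : ∀ k → k ∣ 0ℤ
  k ∣0 = divides 0ℤ (sym (ℤP.*-zeroˡ k))

  ∣-∑ : ∀ {n} {k : ℤ} (f : Fin n → ℤ) → (∀ t → k ∣ f t) → k ∣ ∑[ t < n ] f t
  ∣-∑ {zero}  {k} f _   = k ∣0
  ∣-∑ {suc n}     f k∣f = ∣m∣n⇒∣m+n (k∣f zero) (∣-∑ (f ∘ suc) (k∣f ∘ suc))

  ∑∑ : ∀ {n} → (Fin n → Fin n → ℤ) → ℤ
  ∑∑ {n} F = ∑[ a < n ] ∑[ b < n ] F a b

  ∑∑-cong : ∀ {n} {F G : Fin n → Fin n → ℤ} → (∀ a b → F a b ≡ G a b) → ∑∑ F ≡ ∑∑ G
  ∑∑-cong F≡G = sum-cong-≗ (λ a → sum-cong-≗ (F≡G a))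

  ∑∑-distrib-+ : ∀ {n} (F G : Fin n → Fin n → ℤ) → ∑∑ (λ a b → F a b + G a b) ≡ ∑∑ F + ∑∑ G
  ∑∑-distrib-+ {n} F G = trans (sum-cong-≗ (λ a → ∑-distrib-+ (F a) (G a)))
                               (∑-distrib-+ (λ a → ∑[ b < n ] F a b) (λ a → ∑[ b < n ] G a b))

  ∑∑-distribˡ-* : ∀ {n} c (F : Fin n → Fin n → ℤ) → ∑∑ (λ a b → c * F a b) ≡ c * ∑∑ F
  ∑∑-distribˡ-* {n} c F =
    sym (trans (*-distribˡ-sum c (λ a → ∑[ b < n ] F a b)) (sum-cong-≗ (λ a → *-distribˡ-sum c (F a))))

  ∑∑-swap : ∀ {n} (F : Fin n → Fin n → ℤ) → ∑∑ (λ a b → F b a) ≡ ∑∑ F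
  ∑∑-swap F = ∑-comm (λ a b → F b a)

  ∑∑-permute : ∀ {n} (F : Fin n → Fin n → ℤ) (π : Permutation′ n) →
    ∑∑ (λ a b → F (π ⟨$⟩ʳ a) (π ⟨$⟩ʳ b)) ≡ ∑∑ F
  ∑∑-permute {n} F π = trans (sum-cong-≗ (λ a → sym (∑-permute (F (π ⟨$⟩ʳ a)) π)))
                             (sym (∑-permute (λ a → ∑[ b < n ] F a b) π))

module Inversions where

  open Sums
  open import Data.Integer using (ℤ; +_; _+_; _*_; _-_; -_; 0ℤ; 1ℤ)
  import Data.Integer.Properties as ℤP
  open import Data.Integer.Divisibility.Signed using (_∣_; divides)
  open import Data.Integer.Tactic.RingSolver using (solve-∀)
  open import Data.Bool using (Bool; true; false; not; _∧_; _xor_; if_then_else_)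
  import Data.Bool.Properties as BoolP
  import Data.Fin as Fin
  import Data.Fin.Properties as FinP
  open import Data.Fin.Permutation using (Permutation′; _⟨$⟩ʳ_; _∘ₚ_)
  import Data.Fin.Permutation as Perm
  open import Data.List as List using (allFin; map)
  open import Data.Empty using (⊥-elim)
  open import Function using (_∘_)
  open import Function.Bundles using (Injection)
  open import Function.Properties.Inverse using (↔⇒↣)
  open import Relation.Binary using (tri<; tri≈; tri>)
  open import Relation.Nullary using (¬_; yes; no)
  open import Relation.Nullary.Decidable using (⌊_⌋; dec-true; dec-false; isYes≗does)

  ⟦_⟧ : Bool → ℤ
  ⟦ false ⟧ = 0ℤ
  ⟦ true  ⟧ = 1ℤ

  pos-if≡⟦⟧ : ∀ b → + (if b then 1 else 0) ≡ ⟦ b ⟧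
  pos-if≡⟦⟧ false = refl
  pos-if≡⟦⟧ true  = refl

  ⟦xor⟧ : ∀ x y → ⟦ x xor y ⟧ ≡ ⟦ x ⟧ + ⟦ y ⟧ + - + 2 * (⟦ x ⟧ * ⟦ y ⟧)
  ⟦xor⟧ false false = refl
  ⟦xor⟧ false true  = refl
  ⟦xor⟧ true  false = refl
  ⟦xor⟧ true  true  = refl

  ⟦x⟧*⟦x-xor-y⟧ : ∀ x y → ⟦ x ⟧ * ⟦ x xor y ⟧ ≡ ⟦ x ∧ not y ⟧
  ⟦x⟧*⟦x-xor-y⟧ false y     = refl
  ⟦x⟧*⟦x-xor-y⟧ true  false = refl
  ⟦x⟧*⟦x-xor-y⟧ true  true  = refl

  ⟦x⟧+⟦not-x⟧ : ∀ x → ⟦ x ⟧ + ⟦ not x ⟧ ≡ 1ℤ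
  ⟦x⟧+⟦not-x⟧ false = refl
  ⟦x⟧+⟦not-x⟧ true  = refl

  not-xor-not : ∀ x y → not x xor not y ≡ x xor y
  not-xor-not false false = refl
  not-xor-not false true  = refl
  not-xor-not true  false = refl
  not-xor-not true  true  = refl

  xor-telescope : ∀ x y z → x xor z ≡ (x xor y) xor (y xor z)
  xor-telescope false false z     = refl
  xor-telescope false true  false = refl
  xor-telescope false true  true  = refl
  xor-telescope true  false z     = refl
  xor-telescope true  true  false = refl
  xor-telescope true  true  true  = refl

  infix 4 _<ᵇ_

  _<ᵇ_ : ∀ {n} → Fin n → Fin n → Bool
  a <ᵇ b = ⌊ a Fin.<? b ⌋

  <ᵇ-true : ∀ {n} {a b : Fin n} → a Fin.< b → (a <ᵇ b) ≡ true
  <ᵇ-true {a = a} {b} a<b = trans (isYes≗does (a Fin.<? b)) (dec-true (a Fin.<? b) a<b)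

  <ᵇ-false : ∀ {n} {a b : Fin n} → ¬ a Fin.< b → (a <ᵇ b) ≡ false
  <ᵇ-false {a = a} {b} a≮b = trans (isYes≗does (a Fin.<? b)) (dec-false (a Fin.<? b) a≮b)

  <ᵇ-irrefl : ∀ {n} (a : Fin n) → (a <ᵇ a) ≡ false
  <ᵇ-irrefl a = <ᵇ-false (FinP.<-irrefl refl)

  <ᵇ-flip : ∀ {n} {a b : Fin n} → a ≢ b → (b <ᵇ a) ≡ not (a <ᵇ b)
  <ᵇ-flip {a = a} {b} a≢b with FinP.<-cmp a b
  ... | tri< a<b _ b≮a = trans (<ᵇ-false b≮a) (cong not (sym (<ᵇ-true a<b)))
  ... | tri≈ _ a≡b _   = ⊥-elim (a≢b a≡b)
  ... | tri> a≮b _ b<a = trans (<ᵇ-true b<a) (cong not (sym (<ᵇ-false a≮b)))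

  <ᵇ-asym : ∀ {n} (a b : Fin n) → (a <ᵇ b) ∧ (b <ᵇ a) ≡ false
  <ᵇ-asym a b with a Fin.≟ b
  ... | yes refl = cong (_∧ (a <ᵇ a)) (<ᵇ-irrefl a)
  ... | no a≢b   = trans (cong ((a <ᵇ b) ∧_) (<ᵇ-flip a≢b)) (BoolP.∧-inverseʳ (a <ᵇ b))

  ⟨$⟩ʳ-injective : ∀ {n} (π : Permutation′ n) {a b} → π ⟨$⟩ʳ a ≡ π ⟨$⟩ʳ b → a ≡ b
  ⟨$⟩ʳ-injective π = Injection.injective (↔⇒↣ π)

  ∑∑-symmetric : ∀ {n} (F : Fin n → Fin n → ℤ) → (∀ a b → F a b ≡ F b a) → (∀ a → F a a ≡ 0ℤ) →
    ∑∑ F ≡ + 2 * ∑∑ (λ a b → ⟦ a <ᵇ b ⟧ * F a b)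
  ∑∑-symmetric F F-sym F-diag = begin
    ∑∑ F                          ≡⟨ ∑∑-cong split ⟩
    ∑∑ (λ a b → U a b + L a b)    ≡⟨ ∑∑-distrib-+ U L ⟩
    ∑∑ U + ∑∑ L                   ≡⟨ cong (_+_ (∑∑ U)) L≡U ⟩
    ∑∑ U + ∑∑ U                   ≡⟨ x+x≡2*x (∑∑ U) ⟩
    + 2 * ∑∑ U                    ∎
    where
    open ≡-Reasoning
    x+x≡2*x : ∀ x → x + x ≡ + 2 * x
    x+x≡2*x = solve-∀
    U L : Fin _ → Fin _ → ℤ
    U a b = ⟦ a <ᵇ b ⟧ * F a b
    L a b = ⟦ b <ᵇ a ⟧ * F a b
    L≡U : ∑∑ L ≡ ∑∑ U
    L≡U = trans (sym (∑∑-swap L)) (∑∑-cong (λ a b → cong (⟦ a <ᵇ b ⟧ *_) (F-sym b a)))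
    split : ∀ a b → F a b ≡ U a b + L a b
    split a b with a Fin.≟ b
    ... | yes refl = trans (F-diag a) (sym (trans (cong (λ x → ⟦ x ⟧ * F a a + ⟦ x ⟧ * F a a) (<ᵇ-irrefl a))
                                                  (cong₂ _+_ (ℤP.*-zeroˡ (F a a)) (ℤP.*-zeroˡ (F a a)))))
    ... | no a≢b = begin
      F a b                                   ≡⟨ sym (ℤP.*-identityˡ (F a b)) ⟩
      1ℤ * F a b                              ≡⟨ cong (_* F a b) (sym (⟦x⟧+⟦not-x⟧ (a <ᵇ b))) ⟩
      (⟦ a <ᵇ b ⟧ + ⟦ not (a <ᵇ b) ⟧) * F a b  ≡⟨ cong (λ x → (⟦ a <ᵇ b ⟧ + ⟦ x ⟧) * F a b) (sym (<ᵇ-flip a≢b)) ⟩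
      (⟦ a <ᵇ b ⟧ + ⟦ b <ᵇ a ⟧) * F a b        ≡⟨ ℤP.*-distribʳ-+ (F a b) ⟦ a <ᵇ b ⟧ ⟦ b <ᵇ a ⟧ ⟩
      U a b + L a b                           ∎

  inverted : ∀ {n} → Permutation′ n → Fin n → Fin n → Bool
  inverted π a b = (a <ᵇ b) ∧ (π ⟨$⟩ʳ b <ᵇ π ⟨$⟩ʳ a)

  -- Unlike [inverted] this is symmetric in a and b and composes by xor, which makes the parity of ℓ additive.
  disorder : ∀ {n} → Permutation′ n → Fin n → Fin n → Bool
  disorder π a b = (a <ᵇ b) xor (π ⟨$⟩ʳ a <ᵇ π ⟨$⟩ʳ b)

  len≡∑∑inverted : ∀ {n} (π : Permutation′ n) → + len π ≡ ∑∑ (λ a b → ⟦ inverted π a b ⟧)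
  len≡∑∑inverted {n} π =
    trans (pos-sumℕ-allFin (λ a → List.foldr ℕ._+_ 0 (map (λ b → if inverted π a b then 1 else 0) (allFin n))))
          (sum-cong-≗ (λ a → trans (pos-sumℕ-allFin (λ b → if inverted π a b then 1 else 0))
                                   (sum-cong-≗ (λ b → pos-if≡⟦⟧ (inverted π a b)))))

  len-cong : ∀ {n} (π σ : Permutation′ n) → (∀ a → π ⟨$⟩ʳ a ≡ σ ⟨$⟩ʳ a) → len π ≡ len σ
  len-cong π σ π≗σ = ℤP.+-injective (begin
    + len π                           ≡⟨ len≡∑∑inverted π ⟩
    ∑∑ (λ a b → ⟦ inverted π a b ⟧)   ≡⟨ ∑∑-cong (λ a b → cong₂ (λ u v → ⟦ (a <ᵇ b) ∧ (v <ᵇ u) ⟧) (π≗σ a) (π≗σ b)) ⟩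
    ∑∑ (λ a b → ⟦ inverted σ a b ⟧)   ≡⟨ len≡∑∑inverted σ ⟨
    + len σ                           ∎)
    where open ≡-Reasoning

  len-id : ∀ {n} → len (Perm.id {n}) ≡ 0
  len-id {n} = ℤP.+-injective (begin
    + len (Perm.id {n})                       ≡⟨ len≡∑∑inverted (Perm.id {n}) ⟩
    ∑∑ {n} (λ a b → ⟦ (a <ᵇ b) ∧ (b <ᵇ a) ⟧)   ≡⟨ ∑∑-cong {n} (λ a b → cong ⟦_⟧ (<ᵇ-asym a b)) ⟩
    ∑∑ {n} (λ _ _ → 0ℤ)                       ≡⟨ trans (sum-cong-≗ {n} (λ _ → ∑-zero n)) (∑-zero n) ⟩
    0ℤ                                        ∎)
    where open ≡-Reasoning

  ⟦<ᵇ⟧*⟦disorder⟧ : ∀ {n} (π : Permutation′ n) a b → ⟦ a <ᵇ b ⟧ * ⟦ disorder π a b ⟧ ≡ ⟦ inverted π a b ⟧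
  ⟦<ᵇ⟧*⟦disorder⟧ π a b = trans (⟦x⟧*⟦x-xor-y⟧ (a <ᵇ b) (π ⟨$⟩ʳ a <ᵇ π ⟨$⟩ʳ b)) (cong ⟦_⟧ (sym inverted≡))
    where
    inverted≡ : inverted π a b ≡ (a <ᵇ b) ∧ not (π ⟨$⟩ʳ a <ᵇ π ⟨$⟩ʳ b)
    inverted≡ with a Fin.≟ b
    ... | yes refl = trans (cong (_∧ (π ⟨$⟩ʳ a <ᵇ π ⟨$⟩ʳ a)) (<ᵇ-irrefl a))
                           (cong (_∧ not (π ⟨$⟩ʳ a <ᵇ π ⟨$⟩ʳ a)) (sym (<ᵇ-irrefl a)))
    ... | no a≢b   = cong ((a <ᵇ b) ∧_) (<ᵇ-flip (a≢b ∘ ⟨$⟩ʳ-injective π))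

  disorder-sym : ∀ {n} (π : Permutation′ n) a b → disorder π a b ≡ disorder π b a
  disorder-sym π a b with a Fin.≟ b
  ... | yes refl = refl
  ... | no a≢b   = sym (trans (cong₂ _xor_ (<ᵇ-flip a≢b) (<ᵇ-flip (a≢b ∘ ⟨$⟩ʳ-injective π)))
                              (not-xor-not (a <ᵇ b) (π ⟨$⟩ʳ a <ᵇ π ⟨$⟩ʳ b)))

  disorder-irrefl : ∀ {n} (π : Permutation′ n) a → disorder π a a ≡ false
  disorder-irrefl π a = cong₂ _xor_ (<ᵇ-irrefl a) (<ᵇ-irrefl (π ⟨$⟩ʳ a))

  disorder-∘ₚ : ∀ {n} (π σ : Permutation′ n) a b →
    disorder (π ∘ₚ σ) a b ≡ disorder π a b xor disorder σ (π ⟨$⟩ʳ a) (π ⟨$⟩ʳ b)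
  disorder-∘ₚ π σ a b = xor-telescope (a <ᵇ b) (π ⟨$⟩ʳ a <ᵇ π ⟨$⟩ʳ b) _

  ∑∑-disorder : ∀ {n} (π : Permutation′ n) → ∑∑ (λ a b → ⟦ disorder π a b ⟧) ≡ + 2 * + len π
  ∑∑-disorder π = begin
    ∑∑ (λ a b → ⟦ disorder π a b ⟧)
      ≡⟨ ∑∑-symmetric _ (λ a b → cong ⟦_⟧ (disorder-sym π a b)) (λ a → cong ⟦_⟧ (disorder-irrefl π a)) ⟩
    + 2 * ∑∑ (λ a b → ⟦ a <ᵇ b ⟧ * ⟦ disorder π a b ⟧)
      ≡⟨ cong (+ 2 *_) (trans (∑∑-cong (⟦<ᵇ⟧*⟦disorder⟧ π)) (sym (len≡∑∑inverted π))) ⟩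
    + 2 * + len π ∎
    where open ≡-Reasoning

  ∑∑-disorder-∘ₚ : ∀ {n} (π σ : Permutation′ n) → + 2 * + len (π ∘ₚ σ) ≡
    + 2 * + len π + + 2 * + len σ + - + 2 * ∑∑ (λ a b → ⟦ disorder π a b ⟧ * ⟦ disorder σ (π ⟨$⟩ʳ a) (π ⟨$⟩ʳ b) ⟧)
  ∑∑-disorder-∘ₚ {n} π σ = begin
    + 2 * + len (π ∘ₚ σ)                     ≡⟨ ∑∑-disorder (π ∘ₚ σ) ⟨
    ∑∑ (λ a b → ⟦ disorder (π ∘ₚ σ) a b ⟧)
      ≡⟨ ∑∑-cong (λ a b → trans (cong ⟦_⟧ (disorder-∘ₚ π σ a b))
                                (⟦xor⟧ (disorder π a b) (disorder σ (π ⟨$⟩ʳ a) (π ⟨$⟩ʳ b)))) ⟩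
    ∑∑ (λ a b → x a b + y a b + - + 2 * (x a b * y a b))
      ≡⟨ trans (∑∑-distrib-+ (λ a b → x a b + y a b) (λ a b → - + 2 * (x a b * y a b)))
               (cong₂ _+_ (∑∑-distrib-+ x y) (∑∑-distribˡ-* (- + 2) (λ a b → x a b * y a b))) ⟩
    ∑∑ x + ∑∑ y + - + 2 * ∑∑ (λ a b → x a b * y a b)
      ≡⟨ cong (λ u → u + - + 2 * ∑∑ (λ a b → x a b * y a b))
              (cong₂ _+_ (∑∑-disorder π) (trans (∑∑-permute (λ u v → ⟦ disorder σ u v ⟧) π) (∑∑-disorder σ))) ⟩
    + 2 * + len π + + 2 * + len σ + - + 2 * ∑∑ (λ a b → x a b * y a b) ∎
    where
    open ≡-Reasoning
    x y : Fin n → Fin n → ℤ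
    x a b = ⟦ disorder π a b ⟧
    y a b = ⟦ disorder σ (π ⟨$⟩ʳ a) (π ⟨$⟩ʳ b) ⟧

  len-∘ₚ-parity : ∀ {n} (π σ : Permutation′ n) → + 2 ∣ + len π + + len σ - + len (π ∘ₚ σ)
  len-∘ₚ-parity {n} π σ = divides T (begin
    + len π + + len σ - + len (π ∘ₚ σ)                ≡⟨ cong (λ c → + len π + + len σ - c) len-∘ₚ ⟩
    + len π + + len σ - (+ len π + + len σ - + 2 * T)  ≡⟨ cancel (+ len π) (+ len σ) T ⟩
    T * + 2                                           ∎)
    where
    open ≡-Reasoning
    xy : Fin n → Fin n → ℤ
    xy a b = ⟦ disorder π a b ⟧ * ⟦ disorder σ (π ⟨$⟩ʳ a) (π ⟨$⟩ʳ b) ⟧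
    T : ℤ
    T = ∑∑ (λ a b → ⟦ a <ᵇ b ⟧ * xy a b)
    ∑∑xy≡2T : ∑∑ xy ≡ + 2 * T
    ∑∑xy≡2T = ∑∑-symmetric xy
      (λ a b → cong₂ _*_ (cong ⟦_⟧ (disorder-sym π a b)) (cong ⟦_⟧ (disorder-sym σ (π ⟨$⟩ʳ a) (π ⟨$⟩ʳ b))))
      (λ a → cong (_* ⟦ disorder σ (π ⟨$⟩ʳ a) (π ⟨$⟩ʳ a) ⟧) (cong ⟦_⟧ (disorder-irrefl π a)))
    factor : ∀ a b t → + 2 * a + + 2 * b + - + 2 * (+ 2 * t) ≡ + 2 * (a + b - + 2 * t)
    factor = solve-∀
    cancel : ∀ a b t → a + b - (a + b - + 2 * t) ≡ t * + 2
    cancel = solve-∀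
    len-∘ₚ : + len (π ∘ₚ σ) ≡ + len π + + len σ - + 2 * T
    len-∘ₚ = ℤP.*-cancelˡ-≡ (+ 2) _ _ (trans (∑∑-disorder-∘ₚ π σ)
      (trans (cong (λ u → + 2 * + len π + + 2 * + len σ + - + 2 * u) ∑∑xy≡2T) (factor (+ len π) (+ len σ) T)))

module Arithmetic where

  open import Data.Nat using (zero; suc; NonZero; s≤s; z≤n)
  import Data.Nat.Properties as ℕP
  import Data.Nat.DivMod as ℕDM
  import Data.Nat.Divisibility as ℕD
  open import Data.Nat.GCD using (gcd; gcd-GCD; gcd[m,n]≡0⇒n≡0; module Bézout)
  import Data.Nat.Coprimality as ℕC
  open import Data.Integer using (ℤ; +_; -[1+_]; _+_; _*_; _-_; -_; 1ℤ; ∣_∣)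
  import Data.Integer.Properties as ℤP
  import Data.Integer.DivMod as ℤDM
  import Data.Integer.Coprimality as ℤC
  open import Data.Integer.Divisibility.Signed using (_∣_; divides; ∣ᵤ⇒∣; ∣⇒∣ᵤ; ∣-refl; ∣m∣n⇒∣m+n; ∣n⇒∣m*n)
  open import Data.Integer.Tactic.RingSolver using (solve-∀)
  open import Data.Empty using (⊥-elim)
  open import Relation.Nullary using (¬_)

  private
    pos-eq : ∀ g k l x m → g ℕ.+ k ℕ.* l ≡ x ℕ.* m → + g + + k * + l ≡ + x * + m
    pos-eq g k l x m eq = trans (sym (trans (ℤP.pos-+ g (k ℕ.* l)) (cong (_+_ (+ g)) (ℤP.pos-* k l))))
                                (trans (cong +_ eq) (ℤP.pos-* x m))
    cancelʳ : ∀ g y n → g + y * n + - y * n ≡ g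
    cancelʳ = solve-∀
    cancelˡ : ∀ g x m → - x * m + (g + x * m) ≡ g
    cancelˡ = solve-∀

  m÷n*n≡m : ∀ {m n} → 1 ≤ n → n ∣ℕ m → (m ÷ n) ℕ.* n ≡ m
  m÷n*n≡m {n = suc _} _ n∣m = ℕDM.m/n*n≡m n∣m

  pos-m≡[m÷n]*n : ∀ {m n} → 1 ≤ n → n ∣ℕ m → + m ≡ + (m ÷ n) * + n
  pos-m≡[m÷n]*n {m} {n} 1≤n n∣m = trans (cong +_ (sym (m÷n*n≡m 1≤n n∣m))) (ℤP.pos-* (m ÷ n) n)

  divBy-exact : ∀ z d .{{_ : NonZero d}} → divBy (z * + d) d ≡ z
  divBy-exact z d@(suc _) = sym (ℤP.*-cancelʳ-≡ z quo (+ d) (begin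
    z * + d             ≡⟨ ℤDM.a≡a%n+[a/n]*n (z * + d) (+ d) ⟩
    + rem + quo * + d   ≡⟨ cong (λ k → + k + quo * + d) rem≡0 ⟩
    + 0 + quo * + d     ≡⟨ ℤP.+-identityˡ _ ⟩
    quo * + d           ∎))
    where
    open ≡-Reasoning
    quo : ℤ
    quo = (z * + d) ℤDM./ + d
    rem : ℕ
    rem = (z * + d) ℤDM.% + d
    rem≡[z-quo]d : + rem ≡ (z - quo) * + d
    rem≡[z-quo]d = begin
      + rem                              ≡⟨ add-sub (+ rem) (quo * + d) ⟩
      + rem + quo * + d - quo * + d      ≡⟨ cong (_- quo * + d) (ℤDM.a≡a%n+[a/n]*n (z * + d) (+ d)) ⟨
      z * + d - quo * + d                ≡⟨ sub-distrib z quo (+ d) ⟩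
      (z - quo) * + d                    ∎
      where
      add-sub : ∀ x y → x ≡ x + y - y
      add-sub = solve-∀
      sub-distrib : ∀ x y c → x * c - y * c ≡ (x - y) * c
      sub-distrib = solve-∀
    rem≡0 : rem ≡ 0
    rem≡0 = trans (sym (ℕDM.m<n⇒m%n≡m (ℤDM.n%d<d (z * + d) (+ d))))
                  (ℕD.n∣m⇒m%n≡0 rem d (∣⇒∣ᵤ (divides (z - quo) rem≡[z-quo]d)))

  bezoutℕ : ∀ m n → ∃₂ λ a b → a * + m + b * + n ≡ + gcd m n
  bezoutℕ m n with Bézout.identity (gcd-GCD m n)
  ... | Bézout.+- x y eq = + x , - + y , (begin
    + x * + m + - + y * + n               ≡⟨ cong (λ w → w + - + y * + n) (pos-eq (gcd m n) y n x m eq) ⟨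
    + gcd m n + + y * + n + - + y * + n   ≡⟨ cancelʳ (+ gcd m n) (+ y) (+ n) ⟩
    + gcd m n                             ∎)
    where open ≡-Reasoning
  ... | Bézout.-+ x y eq = - + x , + y , (begin
    - + x * + m + + y * + n               ≡⟨ cong (_+_ (- + x * + m)) (pos-eq (gcd m n) x m y n eq) ⟨
    - + x * + m + (+ gcd m n + + x * + m) ≡⟨ cancelˡ (+ gcd m n) (+ x) (+ m) ⟩
    + gcd m n                             ∎)
    where open ≡-Reasoning

  bezout : ∀ x m → ∃₂ λ a b → a * x + b * + m ≡ + gcd ∣ x ∣ m
  bezout (+ k)     m = bezoutℕ k m
  bezout -[1+ k ] m =
    let a , b , eq = bezoutℕ (suc k) m
    in - a , b , trans (cong (_+ b * + m) (neg-*-neg a (+ suc k))) eq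
    where neg-*-neg : ∀ a x → - a * - x ≡ a * x
          neg-*-neg = solve-∀

  bezout₃ : ∀ x m k → gcd (gcd ∣ x ∣ m) k ≡ 1 →
    ∃ λ a → ∃ λ b → ∃ λ c → a * x + b * + m + c * + k ≡ 1ℤ
  bezout₃ x m k gcd≡1 =
    let a , b , eq₁ = bezout x m
        u , w , eq₂ = bezoutℕ (gcd ∣ x ∣ m) k
    in u * a , u * b , w , (begin
      u * a * x + u * b * + m + w * + k    ≡⟨ regroup u a x b (+ m) w (+ k) ⟩
      u * (a * x + b * + m) + w * + k      ≡⟨ cong (λ g → u * g + w * + k) eq₁ ⟩
      u * + gcd ∣ x ∣ m + w * + k          ≡⟨ trans eq₂ (cong +_ gcd≡1) ⟩
      1ℤ                                   ∎)
    where
    open ≡-Reasoning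
    regroup : ∀ u a x b m w k → u * a * x + u * b * m + w * k ≡ u * (a * x + b * m) + w * k
    regroup = solve-∀

  coprime-divisor : ∀ {x m z} → gcd ∣ x ∣ m ≡ 1 → + m ∣ x * z → + m ∣ z
  coprime-divisor {x} {m} {z} gcd≡1 m∣xz =
    ∣ᵤ⇒∣ (ℤC.coprime-divisor (+ m) x z (ℕC.sym (ℕC.gcd≡1⇒coprime gcd≡1)) (∣⇒∣ᵤ m∣xz))

  coprime₃-divisor : ∀ {x m k e} → gcd (gcd ∣ x ∣ m) k ≡ 1 → + k ∣ e * x → + k ∣ e * + m → + k ∣ e
  coprime₃-divisor {x} {m} {k} {e} gcd≡1 k∣ex k∣em =
    let a , b , c , eq = bezout₃ x m k gcd≡1
    in subst (+ k ∣_) (begin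
      a * (e * x) + b * (e * + m) + c * e * + k   ≡⟨ regroup a b c e x (+ m) (+ k) ⟩
      e * (a * x + b * + m + c * + k)             ≡⟨ cong (e *_) eq ⟩
      e * 1ℤ                                      ≡⟨ ℤP.*-identityʳ e ⟩
      e                                           ∎)
    (∣m∣n⇒∣m+n (∣m∣n⇒∣m+n (∣n⇒∣m*n a k∣ex) (∣n⇒∣m*n b k∣em)) (∣n⇒∣m*n (c * e) ∣-refl))
    where
    open ≡-Reasoning
    regroup : ∀ a b c e x m k → a * (e * x) + b * (e * m) + c * e * k ≡ e * (a * x + b * m + c * k)
    regroup = solve-∀

  1-x≡y : ∀ {x y} → x + y ≡ 1ℤ → 1ℤ - x ≡ y
  1-x≡y {x} {y} x+y≡1 = trans (cong (_- x) (sym x+y≡1)) (add-sub x y)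
    where add-sub : ∀ x y → x + y - x ≡ y
          add-sub = solve-∀

  2≤gcd : ∀ m {n} → 1 ≤ n → gcd m n ≢ 1 → 2 ≤ gcd m n
  2≤gcd m {n} 1≤n gcd≢1 with gcd m n in eq
  ... | zero        = ⊥-elim (ℕP.<⇒≢ 1≤n (sym (gcd[m,n]≡0⇒n≡0 m eq)))
  ... | suc zero    = ⊥-elim (gcd≢1 refl)
  ... | suc (suc _) = s≤s (s≤s z≤n)

  quotient-not-multiple : ∀ {m e} → 1 ≤ m → 2 ≤ e → e ∣ℕ m → ¬ (m ∣ℕ m ÷ e)
  quotient-not-multiple {suc m} {suc (suc e)} _ 2≤e e∣m m∣m/e =
    ℕP.<⇒≱ (ℕDM.m/n<m (suc m) (suc (suc e)) 2≤e) (ℕD.∣⇒≤ m∣m/e)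
    where instance _ = ℕ.>-nonZero (ℕDM.m≥n⇒m/n>0 (ℕD.∣⇒≤ e∣m))
  quotient-not-multiple {suc m} {1} _ (s≤s ()) _ _

module Monomial where

  open Sums
  open import Data.Integer using (ℤ; +_; _+_; _*_; _-_)
  open import Data.Integer.Divisibility.Signed using (_∣_; divides; ∣ᵤ⇒∣; ∣⇒∣ᵤ; ∣-refl; ∣-trans; ∣-reflexive; ∣m⇒∣m*n)
  open import Data.Integer.Tactic.RingSolver using (solve-∀)
  open import Data.Fin.Permutation using (_⟨$⟩ʳ_)

  Δ-sub : ∀ {n} (g h : Elt n) → Δ h - Δ g ≡ ∑[ t < n ] (vec h t - vec g t)
  Δ-sub g h = trans (cong₂ _-_ (Δ≡∑ h) (Δ≡∑ g)) (sym (∑-distrib-- (vec h) (vec g)))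

  Δ-sub-const : ∀ {n} (g h : Elt n) e → Δ h - Δ g - + n * e ≡ ∑[ t < n ] (vec h t - vec g t - e)
  Δ-sub-const {n} g h e = sym (trans (∑-distrib-- (λ t → vec h t - vec g t) (λ _ → e))
                                     (cong₂ _-_ (sym (Δ-sub g h)) (∑-const n e)))

  Δ-· : ∀ {n} (g h : Elt n) → Δ (g · h) ≡ Δ h + Δ g
  Δ-· {n} g h = begin
    Δ (g · h)                                              ≡⟨ Δ≡∑ (g · h) ⟩
    ∑[ t < n ] (vec h t + vec g (perm h ⟨$⟩ʳ t))            ≡⟨ ∑-distrib-+ (vec h) (λ t → vec g (perm h ⟨$⟩ʳ t)) ⟩
    ∑[ t < n ] vec h t + ∑[ t < n ] vec g (perm h ⟨$⟩ʳ t)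
      ≡⟨ cong (_+_ (∑[ t < n ] vec h t)) (∑-permute (vec g) (perm h)) ⟨
    ∑[ t < n ] vec h t + ∑[ t < n ] vec g t                ≡⟨ cong₂ _+_ (Δ≡∑ h) (Δ≡∑ g) ⟨
    Δ h + Δ g                                              ∎
    where open ≡-Reasoning

  module _ {n r q : ℕ} {g h : Elt n} where

    ∼-intro : (s : ℤ) → (∀ t → perm g ⟨$⟩ʳ t ≡ perm h ⟨$⟩ʳ t) → + (r ÷ q) ∣ s →
              (∀ t → + r ∣ vec h t - vec g t - s) → g ∼[ r , q ] h
    ∼-intro s g≗h (divides m s≡mQ) r∣ = g≗h , m , λ t → ∣⇒∣ᵤ (∣-trans (r∣ t) (∣-reflexive (regroup t)))
      where
      shift : ∀ y x m Q → y - x - m * Q ≡ y - (x + Q * m)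
      shift = solve-∀
      regroup : ∀ t → vec h t - vec g t - s ≡ vec h t - (vec g t + + (r ÷ q) * m)
      regroup t = trans (cong (_-_ (vec h t - vec g t)) s≡mQ) (shift (vec h t) (vec g t) m (+ (r ÷ q)))

    ∼-elim : g ∼[ r , q ] h → (∀ t → perm g ⟨$⟩ʳ t ≡ perm h ⟨$⟩ʳ t) ×
             ∃ λ s → + (r ÷ q) ∣ s × (∀ t → + r ∣ vec h t - vec g t - s)
    ∼-elim (g≗h , m , r∣) = g≗h , + (r ÷ q) * m , ∣m⇒∣m*n m ∣-refl ,
      λ t → ∣-trans (∣ᵤ⇒∣ (r∣ t)) (∣-reflexive (shift (vec h t) (vec g t) (+ (r ÷ q)) m))
      where
      shift : ∀ y x Q m → y - (x + Q * m) ≡ y - x - Q * m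
      shift = solve-∀

module Setting (r p q n : ℕ) (1≤p : 1 ≤ p) (1≤q : 1 ≤ q)
               (p∣r : p ∣ℕ r) (q∣r : q ∣ℕ r) (pq∣rn : p ℕ.* q ∣ℕ r ℕ.* n) where

  open Sums
  open Inversions using (len-cong; len-id; len-∘ₚ-parity)
  open Arithmetic
  open Monomial
  open import Data.Nat using (NonZero; suc)
  import Data.Nat.Properties as ℕP
  import Data.Nat.Divisibility as ℕD
  open import Data.Nat.GCD using (gcd; gcd[m,n]∣m; gcd[m,n]∣n; gcd[m,n]≢0)
  open import Data.Integer using (ℤ; +_; _+_; _*_; _-_; -_; 0ℤ; 1ℤ; ∣_∣)
  import Data.Integer.Properties as ℤP
  open import Data.Integer.Divisibility using () renaming (_∣_ to _∣ᵤ_)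
  open import Data.Integer.Divisibility.Signed
    using (_∣_; divides; ∣ᵤ⇒∣; ∣⇒∣ᵤ; ∣-refl; ∣-trans; ∣-reflexive; ∣m∣n⇒∣m+n; ∣m∣n⇒∣m-n; ∣m+n∣m⇒∣n; ∣m+n∣n⇒∣m;
           ∣m⇒∣-m; ∣n⇒∣m*n; ∣m⇒∣m*n; *-monoʳ-∣; *-monoˡ-∣; *-cancelʳ-∣)
  open import Data.Integer.Tactic.RingSolver using (solve-∀)
  open import Data.Fin.Permutation using (_⟨$⟩ʳ_; _∘ₚ_)
  import Data.Fin.Permutation as Perm
  open import Data.Sum using (inj₂)
  open import Relation.Nullary.Decidable using (decidable-stable)

  Q d N M : ℕ
  Q = r ÷ q
  d = d₀ p q n
  N = n ÷ d
  M = (r ℕ.* n) ÷ (p ℕ.* q)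

  d∣p : d ∣ℕ p
  d∣p = ℕD.∣-trans (gcd[m,n]∣m (gcd p q) n) (gcd[m,n]∣m p q)

  d∣q : d ∣ℕ q
  d∣q = ℕD.∣-trans (gcd[m,n]∣m (gcd p q) n) (gcd[m,n]∣n p q)

  d∣n : d ∣ℕ n
  d∣n = gcd[m,n]∣n (gcd p q) n

  instance
    d-nonZero : NonZero d
    d-nonZero = ℕ.≢-nonZero (λ d≡0 → ℕP.<⇒≢ 1≤p (sym (ℕD.0∣⇒≡0 (subst (_∣ℕ p) d≡0 d∣p))))

  r≡Q*q : + r ≡ + Q * + q
  r≡Q*q = pos-m≡[m÷n]*n 1≤q q∣r

  n≡N*d : + n ≡ + N * + d
  n≡N*d = pos-m≡[m÷n]*n (ℕ.>-nonZero⁻¹ d) d∣n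

  M*p≡Q*n : + M * + p ≡ + Q * + n
  M*p≡Q*n = ℤP.*-cancelʳ-≡ (+ M * + p) (+ Q * + n) (+ q) (begin
    + M * + p * + q      ≡⟨ ℤP.*-assoc (+ M) (+ p) (+ q) ⟩
    + M * (+ p * + q)    ≡⟨ cong (+ M *_) (ℤP.pos-* p q) ⟨
    + M * + (p ℕ.* q)    ≡⟨ pos-m≡[m÷n]*n (ℕP.*-mono-≤ 1≤p 1≤q) pq∣rn ⟨
    + (r ℕ.* n)          ≡⟨ ℤP.pos-* r n ⟩
    + r * + n            ≡⟨ cong (_* + n) r≡Q*q ⟩
    + Q * + q * + n      ≡⟨ swap (+ Q) (+ q) (+ n) ⟩
    + Q * + n * + q      ∎)
    where
    open ≡-Reasoning
    instance _ = ℕ.>-nonZero 1≤q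
    swap : ∀ a b c → a * b * c ≡ a * c * b
    swap = solve-∀

  1≤Q : 1 ≤ r → 1 ≤ Q
  1≤Q 1≤r = ℕP.n≢0⇒n>0 (λ Q≡0 → ℕP.<⇒≢ 1≤r (sym (ℤP.+-injective (trans r≡Q*q (cong (λ x → + x * + q) Q≡0)))))

  Q∣r : + Q ∣ + r
  Q∣r = divides (+ q) (trans r≡Q*q (ℤP.*-comm (+ Q) (+ q)))

  InG⇒p∣Δ : (g : Elt n) → InG p g → + p ∣ Δ g
  InG⇒p∣Δ g = ∣ᵤ⇒∣ {+ p} {Δ g}

  p∣Δ⇒InG : (g : Elt n) → + p ∣ Δ g → InG p g
  p∣Δ⇒InG g = ∣⇒∣ᵤ {+ p} {Δ g}

  p∣⇒d∣ : ∀ {x} → + p ∣ x → + d ∣ x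
  p∣⇒d∣ = ∣-trans (∣ᵤ⇒∣ d∣p)

  -- The paper's Δ(x)/d₀; divBy truncates, so D is only ever applied to multiples of d.
  D : ℤ → ℤ
  D x = divBy x d

  D[z*d]≡z : ∀ z → D (z * + d) ≡ z
  D[z*d]≡z z = divBy-exact z d

  D[x]*d≡x : ∀ {x} → + d ∣ x → D x * + d ≡ x
  D[x]*d≡x (divides z refl) = cong (_* + d) (D[z*d]≡z z)

  n*D[x]≡N*x : ∀ {x} → + d ∣ x → + n * D x ≡ + N * x
  n*D[x]≡N*x {x} d∣x = begin
    + n * D x            ≡⟨ cong (_* D x) n≡N*d ⟩
    + N * + d * D x      ≡⟨ ℤP.*-assoc (+ N) (+ d) (D x) ⟩
    + N * (+ d * D x)    ≡⟨ cong (+ N *_) (trans (ℤP.*-comm (+ d) (D x)) (D[x]*d≡x d∣x)) ⟩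
    + N * x              ∎
    where open ≡-Reasoning

  D-+ : ∀ {x y} → + d ∣ x → + d ∣ y → D (x + y) ≡ D x + D y
  D-+ {x} {y} d∣x d∣y = ℤP.*-cancelʳ-≡ (D (x + y)) (D x + D y) (+ d) (begin
    D (x + y) * + d          ≡⟨ D[x]*d≡x (∣m∣n⇒∣m+n d∣x d∣y) ⟩
    x + y                    ≡⟨ cong₂ _+_ (D[x]*d≡x d∣x) (D[x]*d≡x d∣y) ⟨
    D x * + d + D y * + d    ≡⟨ ℤP.*-distribʳ-+ (+ d) (D x) (D y) ⟨
    (D x + D y) * + d        ∎)
    where open ≡-Reasoning

  [Dx-Dy]*d≡x-y : ∀ {x y} → + d ∣ x → + d ∣ y → (D x - D y) * + d ≡ x - y
  [Dx-Dy]*d≡x-y {x} {y} d∣x d∣y = trans (distrib (D x) (D y) (+ d)) (cong₂ _-_ (D[x]*d≡x d∣x) (D[x]*d≡x d∣y))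
    where distrib : ∀ a b c → (a - b) * c ≡ a * c - b * c
          distrib = solve-∀

  [Dx-Dy-Ne]*d≡x-y-ne : ∀ {x y} e → + d ∣ x → + d ∣ y → (D x - D y - + N * e) * + d ≡ x - y - + n * e
  [Dx-Dy-Ne]*d≡x-y-ne {x} {y} e d∣x d∣y = trans (distrib (D x - D y) (+ N) e (+ d))
    (cong₂ (λ u v → u - v * e) ([Dx-Dy]*d≡x-y d∣x d∣y) (sym n≡N*d))
    where distrib : ∀ x N e d → (x - N * e) * d ≡ x * d - N * d * e
          distrib = solve-∀

  r∣z*d⇒Q∣z : ∀ {z} → + r ∣ z * + d → + Q ∣ z
  r∣z*d⇒Q∣z r∣zd = *-cancelʳ-∣ (+ d) (∣-trans Q*d∣r r∣zd)
    where
    Q*d∣r : + Q * + d ∣ + r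
    Q*d∣r = ∣-trans (*-monoʳ-∣ (+ Q) (∣ᵤ⇒∣ d∣q)) (∣-reflexive (sym r≡Q*q))

  p∣n*e⇒Q∣e*M : ∀ {e} → + p ∣ + n * e → + Q ∣ e * + M
  p∣n*e⇒Q∣e*M {e} p∣ne = *-cancelʳ-∣ (+ p) (∣-trans (*-monoʳ-∣ (+ Q) p∣ne) (∣-reflexive (begin
    + Q * (+ n * e)      ≡⟨ reassoc (+ Q) (+ n) e ⟩
    e * (+ Q * + n)      ≡⟨ cong (e *_) M*p≡Q*n ⟨
    e * (+ M * + p)      ≡⟨ ℤP.*-assoc e (+ M) (+ p) ⟨
    e * + M * + p        ∎)))
    where
    open ≡-Reasoning
    instance _ = ℕ.>-nonZero 1≤p
    reassoc : ∀ a b c → a * (b * c) ≡ c * (a * b)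
    reassoc = solve-∀

  module Automorphism (j k i : ℤ) where

    φ : Elt n → Elt n
    φ = α p q n j k i

    shift : Elt n → ℤ
    shift g = i * + len (perm g) + D (Δ g) * k

    A : ℤ
    A = + N * k + j

    φ-vec-diff : ∀ {g h} → len (perm g) ≡ len (perm h) → ∀ t →
      vec (φ h) t - vec (φ g) t ≡ (D (Δ h) - D (Δ g)) * k + j * (vec h t - vec g t)
    φ-vec-diff {g} {h} ℓg≡ℓh t =
      trans (cong (λ ℓ → i * + ℓ + D (Δ h) * k + j * vec h t - vec (φ g) t) (sym ℓg≡ℓh))
            (diff (i * + len (perm g)) (D (Δ h)) (D (Δ g)) k j (vec h t) (vec g t))
      where
      diff : ∀ c Dh Dg k j y x → c + Dh * k + j * y - (c + Dg * k + j * x) ≡ (Dh - Dg) * k + j * (y - x)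
      diff = solve-∀

    φ-∼-intro : ∀ {g h} → (∀ t → perm g ⟨$⟩ʳ t ≡ perm h ⟨$⟩ʳ t) → (s : ℤ) → + Q ∣ s →
      (∀ t → + r ∣ (D (Δ h) - D (Δ g)) * k + j * (vec h t - vec g t) - s) → φ g ∼[ r , q ] φ h
    φ-∼-intro {g} {h} g≗h s Q∣s r∣ = ∼-intro {n} {r} {q} {φ g} {φ h} s g≗h Q∣s λ t →
      subst (λ x → + r ∣ x - s) (sym (φ-vec-diff {g} {h} (len-cong (perm g) (perm h) g≗h) t)) (r∣ t)

    φ-∼-elim : ∀ {g h} → φ g ∼[ r , q ] φ h → (∀ t → perm g ⟨$⟩ʳ t ≡ perm h ⟨$⟩ʳ t) ×
      ∃ λ s → + Q ∣ s × (∀ t → + r ∣ (D (Δ h) - D (Δ g)) * k + j * (vec h t - vec g t) - s)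
    φ-∼-elim {g} {h} φg∼φh =
      let g≗h , s , Q∣s , r∣ = ∼-elim {n} {r} {q} {φ g} {φ h} φg∼φh
      in g≗h , s , Q∣s , λ t →
           subst (λ x → + r ∣ x - s) (φ-vec-diff {g} {h} (len-cong (perm g) (perm h) g≗h) t) (r∣ t)

    φ-preserves-G : + p ∣ᵤ + n * i → ∀ g → InG p g → InG p (φ g)
    φ-preserves-G p∣ni g InG-g = p∣Δ⇒InG (φ g) (subst (+ p ∣_) (sym expand)
      (∣m∣n⇒∣m+n (∣m∣n⇒∣m+n (∣m⇒∣m*n L (∣ᵤ⇒∣ {+ p} {+ n * i} p∣ni)) (∣m⇒∣m*n k (∣n⇒∣m*n (+ N) p∣Δg)))
                 (∣n⇒∣m*n j p∣Δg)))
      where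
      L : ℤ
      L = + len (perm g)
      p∣Δg : + p ∣ Δ g
      p∣Δg = InG⇒p∣Δ g InG-g
      expand : Δ (φ g) ≡ + n * i * L + + N * Δ g * k + j * Δ g
      expand = begin
        Δ (φ g)                                     ≡⟨ Δ≡∑ (φ g) ⟩
        ∑[ t < n ] (shift g + j * vec g t)          ≡⟨ ∑-affine n (shift g) j (vec g) ⟩
        + n * shift g + j * ∑[ t < n ] vec g t      ≡⟨ cong (λ x → + n * shift g + j * x) (Δ≡∑ g) ⟨
        + n * (i * L + D (Δ g) * k) + j * Δ g       ≡⟨ distrib (+ n) i L (D (Δ g)) k (j * Δ g) ⟩
        + n * i * L + + n * D (Δ g) * k + j * Δ g
          ≡⟨ cong (λ x → + n * i * L + x * k + j * Δ g) (n*D[x]≡N*x (p∣⇒d∣ p∣Δg)) ⟩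
        + n * i * L + + N * Δ g * k + j * Δ g       ∎
        where
        open ≡-Reasoning
        distrib : ∀ n i L D k x → n * (i * L + D * k) + x ≡ n * i * L + n * D * k + x
        distrib = solve-∀

    φ-resp-≈ : ∀ g h → InG p g → InG p h → g ≈[ r ] h → φ g ∼[ r , q ] φ h
    φ-resp-≈ g h InG-g InG-h (g≗h , g≡h) =
      φ-∼-intro {g} {h} g≗h s Q∣s λ t → subst (+ r ∣_) (sym (cancel s j (vec h t - vec g t))) (∣n⇒∣m*n j (r∣h-g t))
      where
      s : ℤ
      s = (D (Δ h) - D (Δ g)) * k
      p∣Δg : + p ∣ Δ g
      p∣Δg = InG⇒p∣Δ g InG-g
      p∣Δh : + p ∣ Δ h
      p∣Δh = InG⇒p∣Δ h InG-h
      r∣h-g : ∀ t → + r ∣ vec h t - vec g t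
      r∣h-g t = subst (+ r ∣_) (neg-sub (vec g t) (vec h t)) (∣m⇒∣-m (∣ᵤ⇒∣ {+ r} {vec g t - vec h t} (g≡h t)))
        where neg-sub : ∀ a b → - (a - b) ≡ b - a
              neg-sub = solve-∀
      Q∣s : + Q ∣ s
      Q∣s = ∣m⇒∣m*n k (r∣z*d⇒Q∣z {D (Δ h) - D (Δ g)}
        (subst (+ r ∣_) (trans (sym (Δ-sub g h)) (sym ([Dx-Dy]*d≡x-y (p∣⇒d∣ p∣Δh) (p∣⇒d∣ p∣Δg))))
               (∣-∑ (λ t → vec h t - vec g t) r∣h-g)))
      cancel : ∀ s j w → s + j * w - s ≡ j * w
      cancel = solve-∀

    z²≡1⇒Q∣2i : Fin n → (cpow i · cpow i) ∼[ r , q ] ε → + Q ∣ i + i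
    z²≡1⇒Q∣2i t₀ c²∼ε =
      let _ , s , Q∣s , r∣ = ∼-elim {n} {r} {q} {cpow i · cpow i} {ε} c²∼ε
      in subst (+ Q ∣_) (isolate (i + i) s) (∣m⇒∣-m (∣m∣n⇒∣m+n (∣-trans Q∣r (r∣ t₀)) Q∣s))
      where
      isolate : ∀ a s → - (0ℤ - a - s + s) ≡ a
      isolate = solve-∀

    φ-homomorphic : + Q ∣ i + i → ∀ g h → InG p g → InG p h → φ (g · h) ∼[ r , q ] (φ g · φ h)
    φ-homomorphic Q∣2i g h InG-g InG-h =
      ∼-intro {n} {r} {q} {φ (g · h)} {φ g · φ h} s (λ _ → refl) Q∣s λ t →
        subst (+ r ∣_) (sym (vanish t)) ((+ r) ∣0)
      where
      Lh Lg Lgh : ℤ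
      Lh = + len (perm h)
      Lg = + len (perm g)
      Lgh = + len (perm h ∘ₚ perm g)
      s = i * (Lh + Lg - Lgh)
      Q∣s : + Q ∣ s
      Q∣s = let divides T Lh+Lg-Lgh≡T*2 = len-∘ₚ-parity (perm h) (perm g)
            in subst (+ Q ∣_) (sym (trans (cong (i *_) Lh+Lg-Lgh≡T*2) (double i T))) (∣m⇒∣m*n T Q∣2i)
        where double : ∀ i T → i * (T * + 2) ≡ (i + i) * T
              double = solve-∀
      D[Δ[g·h]] : D (Δ (g · h)) ≡ D (Δ h) + D (Δ g)
      D[Δ[g·h]] = trans (cong D (Δ-· g h)) (D-+ (p∣⇒d∣ (InG⇒p∣Δ h InG-h)) (p∣⇒d∣ (InG⇒p∣Δ g InG-g)))
      vanish : ∀ t → vec (φ g · φ h) t - vec (φ (g · h)) t - s ≡ 0ℤ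
      vanish t = trans (cong (λ D′ → vec (φ g · φ h) t - (i * Lgh + D′ * k + j * vec (g · h) t) - s) D[Δ[g·h]])
                       (cancel i Lh Lg Lgh (D (Δ h)) (D (Δ g)) k j (vec h t) (vec g (perm h ⟨$⟩ʳ t)))
        where
        cancel : ∀ i Lh Lg Lgh Dh Dg k j x y →
          i * Lh + Dh * k + j * x + (i * Lg + Dg * k + j * y) - (i * Lgh + (Dh + Dg) * k + j * (x + y))
            - i * (Lh + Lg - Lgh) ≡ 0ℤ
        cancel = solve-∀

    φ-kills-C_q : ∀ m → φ (cpow (+ Q * m)) ∼[ r , q ] ε
    φ-kills-C_q m = ∼-intro {n} {r} {q} {φ c} {ε} (- v) (λ _ → refl) (∣m⇒∣-m Q∣v) λ t →
      subst (+ r ∣_) (sym (cancel v)) ((+ r) ∣0)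
      where
      c : Elt n
      c = cpow (+ Q * m)
      v : ℤ
      v = shift c + j * (+ Q * m)
      D[Δc] : D (Δ c) ≡ + N * (+ Q * m)
      D[Δc] = trans (cong D (begin
        Δ c                      ≡⟨ Δ≡∑ c ⟩
        ∑[ t < n ] (+ Q * m)     ≡⟨ ∑-const n (+ Q * m) ⟩
        + n * (+ Q * m)          ≡⟨ cong (_* (+ Q * m)) n≡N*d ⟩
        + N * + d * (+ Q * m)    ≡⟨ swap (+ N) (+ d) (+ Q * m) ⟩
        + N * (+ Q * m) * + d    ∎)) (D[z*d]≡z (+ N * (+ Q * m)))
        where
        open ≡-Reasoning
        swap : ∀ a b c → a * b * c ≡ a * c * b
        swap = solve-∀
      Q∣v : + Q ∣ v
      Q∣v = subst (+ Q ∣_) (sym (begin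
        i * + len (perm c) + D (Δ c) * k + j * (+ Q * m)
          ≡⟨ cong₂ (λ ℓ D′ → i * + ℓ + D′ * k + j * (+ Q * m)) (len-id {n}) D[Δc] ⟩
        i * + 0 + + N * (+ Q * m) * k + j * (+ Q * m)     ≡⟨ factor i (+ N) (+ Q) m k j ⟩
        + Q * (+ N * m * k + j * m)                       ∎)) (∣m⇒∣m*n (+ N * m * k + j * m) ∣-refl)
        where
        open ≡-Reasoning
        factor : ∀ i N Q m k j → i * + 0 + N * (Q * m) * k + j * (Q * m) ≡ Q * (N * m * k + j * m)
        factor = solve-∀
      cancel : ∀ v → 0ℤ - v - - v ≡ 0ℤ
      cancel = solve-∀

    φ-Injective : Set
    φ-Injective = ∀ g h → InG p g → InG p h → φ g ∼[ r , q ] φ h → g ∼[ r , q ] h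

    -- All differences h_t − g_t are congruent to e = h_{t₀} − g_{t₀}, and the two gcd conditions
    -- make e a multiple of Q.
    φ-injective : gcd ∣ j ∣ r ≡ 1 → gcd (gcd ∣ A ∣ M) Q ≡ 1 → Fin n → φ-Injective
    φ-injective coprime-j coprime-A t₀ g h InG-g InG-h φg∼φh =
      let g≗h , s , Q∣s , r∣ = φ-∼-elim {g} {h} φg∼φh
          W : Fin n → ℤ
          W t = vec h t - vec g t
          ΔD : ℤ
          ΔD = D (Δ h) - D (Δ g)
          C : ℤ
          C = s - ΔD * k
          e : ℤ
          e = W t₀
          r∣jW-C : ∀ t → + r ∣ j * W t - C
          r∣jW-C t = subst (+ r ∣_) (regroup ΔD k j (W t) s) (r∣ t)
          r∣W-e : ∀ t → + r ∣ W t - e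
          r∣W-e t = coprime-divisor {j} {r} {W t - e} coprime-j
            (subst (+ r ∣_) (sub-sub j (W t) e C) (∣m∣n⇒∣m-n (r∣jW-C t) (r∣jW-C t₀)))
          r∣ΔW-ne : + r ∣ Δ h - Δ g - + n * e
          r∣ΔW-ne = subst (+ r ∣_) (sym (Δ-sub-const g h e)) (∣-∑ (λ t → W t - e) r∣W-e)
          Q∣ΔD-Ne : + Q ∣ ΔD - + N * e
          Q∣ΔD-Ne = r∣z*d⇒Q∣z {ΔD - + N * e}
            (subst (+ r ∣_) (sym ([Dx-Dy-Ne]*d≡x-y-ne e (p∣⇒d∣ p∣Δh) (p∣⇒d∣ p∣Δg))) r∣ΔW-ne)
          Q∣eA : + Q ∣ e * A
          Q∣eA = subst (+ Q ∣_) (sym (expand-eA e (+ N) k j s ΔD))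
            (∣m∣n⇒∣m-n (∣m∣n⇒∣m+n (∣-trans Q∣r (r∣jW-C t₀)) Q∣s) (∣m⇒∣m*n k Q∣ΔD-Ne))
          p∣ne : + p ∣ + n * e
          p∣ne = subst (+ p ∣_) (sub-self (Δ h - Δ g) (+ n * e))
            (∣m∣n⇒∣m-n (∣m∣n⇒∣m-n p∣Δh p∣Δg) (∣-trans (∣ᵤ⇒∣ p∣r) r∣ΔW-ne))
          Q∣e : + Q ∣ e
          Q∣e = coprime₃-divisor {A} {M} {Q} {e} coprime-A Q∣eA (p∣n*e⇒Q∣e*M {e} p∣ne)
      in ∼-intro {n} {r} {q} {g} {h} e g≗h Q∣e r∣W-e
      where
      p∣Δg : + p ∣ Δ g
      p∣Δg = InG⇒p∣Δ g InG-g
      p∣Δh : + p ∣ Δ h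
      p∣Δh = InG⇒p∣Δ h InG-h
      regroup : ∀ ΔD k j w s → ΔD * k + j * w - s ≡ j * w - (s - ΔD * k)
      regroup = solve-∀
      sub-sub : ∀ j w e C → j * w - C - (j * e - C) ≡ j * (w - e)
      sub-sub = solve-∀
      expand-eA : ∀ e N k j s ΔD → e * (N * k + j) ≡ j * e - (s - ΔD * k) + s - (ΔD - N * e) * k
      expand-eA = solve-∀
      sub-self : ∀ x y → x - (x - y) ≡ y
      sub-self = solve-∀

    -- a inverts j modulo r, and u = −a k c₁ makes the shift of h equal to Z a k (1 − c₁ A)
    -- = Z a k (c₂ M + c₃ Q) modulo r, a multiple of Q because Q ∣ Z M.
    module Preimage (a b : ℤ) (ab≡1 : a * j + b * + r ≡ 1ℤ)
                    (c₁ c₂ c₃ : ℤ) (c≡1 : c₁ * A + c₂ * + M + c₃ * + Q ≡ 1ℤ)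
                    (p∣ni : + p ∣ᵤ + n * i) (g : Elt n) (InG-g : InG p g) where

      L z Z u : ℤ
      L = + len (perm g)
      z = Δ g - + n * (i * L)
      Z = D z
      u = - (a * k * c₁)

      h : Elt n
      h = ⟨ perm g , (λ t → Z * u + a * (vec g t - i * L)) ⟩

      p∣z : + p ∣ z
      p∣z = ∣m∣n⇒∣m-n (InG⇒p∣Δ g InG-g)
                      (subst (+ p ∣_) (ℤP.*-assoc (+ n) i L) (∣m⇒∣m*n L (∣ᵤ⇒∣ {+ p} {+ n * i} p∣ni)))

      n*Z≡N*z : + n * Z ≡ + N * z
      n*Z≡N*z = n*D[x]≡N*x (p∣⇒d∣ p∣z)

      Δh : Δ h ≡ + n * (Z * u) + a * z
      Δh = begin
        Δ h                                                ≡⟨ Δ≡∑ h ⟩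
        ∑[ t < n ] (Z * u + a * (vec g t - i * L))         ≡⟨ ∑-affine n (Z * u) a (λ t → vec g t - i * L) ⟩
        + n * (Z * u) + a * ∑[ t < n ] (vec g t - i * L)   ≡⟨ cong (λ x → + n * (Z * u) + a * x) ∑[y-iL]≡z ⟩
        + n * (Z * u) + a * z                              ∎
        where
        open ≡-Reasoning
        ∑[y-iL]≡z : ∑[ t < n ] (vec g t - i * L) ≡ z
        ∑[y-iL]≡z = trans (∑-distrib-- (vec g) (λ _ → i * L)) (cong₂ _-_ (sym (Δ≡∑ g)) (∑-const n (i * L)))

      InG-h : InG p h
      InG-h = p∣Δ⇒InG h (subst (+ p ∣_) (sym Δh)
        (∣m∣n⇒∣m+n (subst (+ p ∣_) (trans (cong (_* u) (sym n*Z≡N*z)) (ℤP.*-assoc (+ n) Z u))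
                                   (∣m⇒∣m*n u (∣n⇒∣m*n (+ N) p∣z)))
                   (∣n⇒∣m*n a p∣z)))

      D[Δh] : D (Δ h) ≡ (+ N * u + a) * Z
      D[Δh] = trans (cong D (trans Δh (begin
        + n * (Z * u) + a * z
          ≡⟨ cong₂ (λ x y → x * (Z * u) + a * y) n≡N*d (sym (D[x]*d≡x (p∣⇒d∣ p∣z))) ⟩
        + N * + d * (Z * u) + a * (Z * + d)    ≡⟨ factor (+ N) (+ d) Z u a ⟩
        (+ N * u + a) * Z * + d                ∎))) (D[z*d]≡z ((+ N * u + a) * Z))
        where
        open ≡-Reasoning
        factor : ∀ N d Z u a → N * d * (Z * u) + a * (Z * d) ≡ (N * u + a) * Z * d
        factor = solve-∀

      s : ℤ
      s = D (Δ h) * k + j * (Z * u)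

      Q∣s : + Q ∣ s
      Q∣s = subst (+ Q ∣_) (sym (begin
        D (Δ h) * k + j * (Z * u)                        ≡⟨ cong (λ x → x * k + j * (Z * u)) D[Δh] ⟩
        (+ N * u + a) * Z * k + j * (Z * u)              ≡⟨ collect (+ N) a Z k j c₁ ⟩
        Z * (a * k) * (1ℤ - c₁ * A)                      ≡⟨ cong (λ x → Z * (a * k) * x) (1-x≡y {c₁ * A} c₁A+rest≡1) ⟩
        Z * (a * k) * (c₂ * + M + c₃ * + Q)              ≡⟨ spread Z (a * k) c₂ (+ M) c₃ (+ Q) ⟩
        a * k * c₂ * (Z * + M) + a * k * c₃ * Z * + Q    ∎))
        (∣m∣n⇒∣m+n (∣n⇒∣m*n (a * k * c₂) (p∣n*e⇒Q∣e*M {Z} (subst (+ p ∣_) (sym n*Z≡N*z) (∣n⇒∣m*n (+ N) p∣z))))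
                   (∣n⇒∣m*n (a * k * c₃ * Z) ∣-refl))
        where
        open ≡-Reasoning
        c₁A+rest≡1 : c₁ * A + (c₂ * + M + c₃ * + Q) ≡ 1ℤ
        c₁A+rest≡1 = trans (sym (ℤP.+-assoc (c₁ * A) (c₂ * + M) (c₃ * + Q))) c≡1
        collect : ∀ N a Z k j c₁ → (N * - (a * k * c₁) + a) * Z * k + j * (Z * - (a * k * c₁))
                                     ≡ Z * (a * k) * (1ℤ - c₁ * (N * k + j))
        collect = solve-∀
        spread : ∀ Z ak c₂ M c₃ Q → Z * ak * (c₂ * M + c₃ * Q) ≡ ak * c₂ * (Z * M) + ak * c₃ * Z * Q
        spread = solve-∀

      φh∼g : φ h ∼[ r , q ] g
      φh∼g = ∼-intro {n} {r} {q} {φ h} {g} (- s) (λ _ → refl) (∣m⇒∣-m Q∣s) λ t →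
        subst (+ r ∣_) (sym (r-multiple t)) (∣n⇒∣m*n (vec g t - i * L) (∣n⇒∣m*n b ∣-refl))
        where
        expand : ∀ y iL Dk j Zu a → y - (iL + Dk + j * (Zu + a * (y - iL))) - - (Dk + j * Zu) ≡ (y - iL) * (1ℤ - a * j)
        expand = solve-∀
        r-multiple : ∀ t → vec g t - vec (φ h) t - - s ≡ (vec g t - i * L) * (b * + r)
        r-multiple t = trans (expand (vec g t) (i * L) (D (Δ h) * k) j (Z * u) a)
                             (cong (λ x → (vec g t - i * L) * x) (1-x≡y {a * j} ab≡1))

    φ-surjective : gcd ∣ j ∣ r ≡ 1 → gcd (gcd ∣ A ∣ M) Q ≡ 1 → + p ∣ᵤ + n * i →
      ∀ g → InG p g → ∃ λ h → InG p h × φ h ∼[ r , q ] g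
    φ-surjective coprime-j coprime-A p∣ni g InG-g =
      let a , b , ab≡gcd = bezout j r
          c₁ , c₂ , c₃ , c≡1 = bezout₃ A M Q coprime-A
          open Preimage a b (trans ab≡gcd (cong +_ coprime-j)) c₁ c₂ c₃ c≡1 p∣ni g InG-g
      in h , InG-h , φh∼g

    Δε≡0 : Δ (ε {n}) ≡ 0ℤ
    Δε≡0 = trans (Δ≡∑ (ε {n})) (∑-zero n)

    InG-ε : InG p (ε {n})
    InG-ε = p∣Δ⇒InG ε (subst (+ p ∣_) (sym Δε≡0) ((+ p) ∣0))

    injective-on-ε : φ-Injective → ∀ g → InG p g → φ ε ∼[ r , q ] φ g →
      ∃ λ s → + Q ∣ s × (∀ t → + r ∣ vec g t - s)
    injective-on-ε inj g InG-g φε∼φg =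
      let _ , s , Q∣s , r∣ = ∼-elim {n} {r} {q} {ε} {g} (inj ε g InG-ε InG-g φε∼φg)
      in s , Q∣s , λ t → subst (λ w → + r ∣ w - s) (ℤP.+-identityʳ (vec g t)) (r∣ t)

    diagonal-in-kernel : (x : Fin n → ℤ) → Δ ⟨ Perm.id , x ⟩ ≡ 0ℤ → (∀ t → + r ∣ j * x t) →
      φ ε ∼[ r , q ] φ ⟨ Perm.id , x ⟩
    diagonal-in-kernel x Δx≡0 r∣jx = φ-∼-intro {ε} {g} (λ _ → refl) 0ℤ ((+ Q) ∣0) λ t →
      subst (+ r ∣_) (sym (trans (cong (λ w → (w - D (Δ (ε {n}))) * k + j * (x t - 0ℤ) - 0ℤ) D[Δg]≡D[Δε])
                                 (vanish (D (Δ (ε {n}))) k j (x t))))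
                     (r∣jx t)
      where
      g : Elt n
      g = ⟨ Perm.id , x ⟩
      D[Δg]≡D[Δε] : D (Δ g) ≡ D (Δ (ε {n}))
      D[Δg]≡D[Δε] = cong D (trans Δx≡0 (sym Δε≡0))
      vanish : ∀ D k j x → (D - D) * k + j * (x - 0ℤ) - 0ℤ ≡ j * x
      vanish = solve-∀

    scalar-in-kernel : ∀ s₀ → + Q ∣ s₀ * A → φ ε ∼[ r , q ] φ (cpow s₀)
    scalar-in-kernel s₀ Q∣s₀A = φ-∼-intro {ε} {cpow s₀} (λ _ → refl) (s₀ * A) Q∣s₀A λ t →
      subst (+ r ∣_) (sym (trans (cong₂ (λ u v → (u - v) * k + j * (s₀ - 0ℤ) - s₀ * A) D[Δc] D[Δε])
                                 (vanish (+ N) s₀ k j)))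
                     ((+ r) ∣0)
      where
      swap : ∀ a b c → a * b * c ≡ a * c * b
      swap = solve-∀
      D[Δc] : D (Δ (cpow {n} s₀)) ≡ + N * s₀
      D[Δc] = trans (cong D (trans (Δ≡∑ (cpow {n} s₀)) (trans (∑-const n s₀)
                      (trans (cong (_* s₀) n≡N*d) (swap (+ N) (+ d) s₀)))))
                    (D[z*d]≡z (+ N * s₀))
      D[Δε] : D (Δ (ε {n})) ≡ 0ℤ
      D[Δε] = trans (cong D (trans Δε≡0 (sym (ℤP.*-zeroˡ (+ d))))) (D[z*d]≡z 0ℤ)
      vanish : ∀ N s k j → (N * s - 0ℤ) * k + j * (s - 0ℤ) - s * (N * k + j) ≡ 0ℤ
      vanish = solve-∀

    -- For e = gcd(j, r) > 1 the element x = (r/e, −r/e, 0, …) lies outside C_q, although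
    -- j x ≡ 0 (mod r) and Δ(x) = 0 give it the same image as the identity.
    injective⇒coprime-j : ∀ {n′} → n ≡ suc (suc (suc n′)) → 1 ≤ r → φ-Injective → gcd ∣ j ∣ r ≡ 1
    injective⇒coprime-j {n′} refl 1≤r inj = decidable-stable (gcd ∣ j ∣ r ℕ.≟ 1) λ e≢1 →
      let s , _ , r∣ = injective-on-ε inj g InG-g (diagonal-in-kernel x Δg≡0 r∣jx)
          r∣-s : + r ∣ - s
          r∣-s = ∣m+n∣m⇒∣n {+ r} {0ℤ} { - s } (r∣ (suc (suc zero))) ((+ r) ∣0)
          r∣t₀ : + r ∣ + t₀
          r∣t₀ = ∣m+n∣n⇒∣m {+ r} {+ t₀} { - s } (r∣ zero) r∣-s
      in quotient-not-multiple 1≤r (2≤gcd ∣ j ∣ 1≤r e≢1) e∣r (∣⇒∣ᵤ {+ r} {+ t₀} r∣t₀)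
      where
      e t₀ : ℕ
      e = gcd ∣ j ∣ r
      t₀ = r ÷ e
      e∣r : e ∣ℕ r
      e∣r = gcd[m,n]∣n ∣ j ∣ r
      x : Fin n → ℤ
      x zero          = + t₀
      x (suc zero)    = - + t₀
      x (suc (suc _)) = 0ℤ
      g : Elt n
      g = ⟨ Perm.id , x ⟩
      Δg≡0 : Δ g ≡ 0ℤ
      Δg≡0 = trans (Δ≡∑ g) (trans (cong (λ w → + t₀ + (- + t₀ + (0ℤ + w))) (∑-zero n′)) (cancel (+ t₀)))
        where cancel : ∀ t → t + (- t + (0ℤ + 0ℤ)) ≡ 0ℤ
              cancel = solve-∀
      InG-g : InG p g
      InG-g = p∣Δ⇒InG g (subst (+ p ∣_) (sym Δg≡0) ((+ p) ∣0))
      r∣jt₀ : + r ∣ j * + t₀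
      r∣jt₀ = ∣-trans (∣-reflexive r≡e*t₀) (*-monoˡ-∣ (+ t₀) (∣ᵤ⇒∣ {+ e} {j} (gcd[m,n]∣m ∣ j ∣ r)))
        where
        1≤e : 1 ≤ e
        1≤e = ℕP.n≢0⇒n>0 (gcd[m,n]≢0 ∣ j ∣ r (inj₂ (ℕP.m<n⇒n≢0 1≤r)))
        r≡e*t₀ : + r ≡ + e * + t₀
        r≡e*t₀ = trans (pos-m≡[m÷n]*n 1≤e e∣r) (ℤP.*-comm (+ t₀) (+ e))
      r∣jx : ∀ t → + r ∣ j * x t
      r∣jx zero          = r∣jt₀
      r∣jx (suc zero)    = subst (+ r ∣_) (ℤP.neg-distribʳ-* j (+ t₀)) (∣m⇒∣-m r∣jt₀)
      r∣jx (suc (suc _)) = subst (+ r ∣_) (sym (ℤP.*-zeroʳ j)) ((+ r) ∣0)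

    -- For G = gcd(A, M, Q) > 1 the scalar c^(Q/G) lies outside C_q, although its shift
    -- (Q/G)·A is a multiple of Q.
    injective⇒coprime-A : Fin n → 1 ≤ r → φ-Injective → gcd (gcd ∣ A ∣ M) Q ≡ 1
    injective⇒coprime-A t₀ 1≤r inj = decidable-stable (gcd (gcd ∣ A ∣ M) Q ℕ.≟ 1) λ G≢1 →
      let s , Q∣s , r∣ = injective-on-ε inj (cpow {n} (+ s₀)) InG-c (scalar-in-kernel (+ s₀) Q∣s₀A)
          Q∣s₀ : + Q ∣ + s₀
          Q∣s₀ = ∣m+n∣n⇒∣m {+ Q} {+ s₀} { - s } (∣-trans Q∣r (r∣ t₀)) (∣m⇒∣-m Q∣s)
      in quotient-not-multiple (1≤Q 1≤r) (2≤gcd (gcd ∣ A ∣ M) (1≤Q 1≤r) G≢1) G∣Q (∣⇒∣ᵤ {+ Q} {+ s₀} Q∣s₀)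
      where
      G s₀ : ℕ
      G = gcd (gcd ∣ A ∣ M) Q
      s₀ = Q ÷ G
      G∣Q : G ∣ℕ Q
      G∣Q = gcd[m,n]∣n (gcd ∣ A ∣ M) Q
      G∣A : + G ∣ A
      G∣A = ∣ᵤ⇒∣ {+ G} {A} (ℕD.∣-trans (gcd[m,n]∣m (gcd ∣ A ∣ M) Q) (gcd[m,n]∣m ∣ A ∣ M))
      G∣M : + G ∣ + M
      G∣M = ∣ᵤ⇒∣ (ℕD.∣-trans (gcd[m,n]∣m (gcd ∣ A ∣ M) Q) (gcd[m,n]∣n ∣ A ∣ M))
      1≤G : 1 ≤ G
      1≤G = ℕP.n≢0⇒n>0 (gcd[m,n]≢0 (gcd ∣ A ∣ M) Q (inj₂ (ℕP.m<n⇒n≢0 (1≤Q 1≤r))))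
      Q≡s₀*G : + Q ≡ + s₀ * + G
      Q≡s₀*G = pos-m≡[m÷n]*n 1≤G G∣Q
      Q∣s₀A : + Q ∣ + s₀ * A
      Q∣s₀A = ∣-trans (∣-reflexive Q≡s₀*G) (*-monoʳ-∣ (+ s₀) G∣A)
      InG-c : InG p (cpow {n} (+ s₀))
      InG-c = let divides m M≡m*G = G∣M in
        p∣Δ⇒InG (cpow {n} (+ s₀)) (divides m (trans (Δ≡∑ (cpow {n} (+ s₀))) (trans (∑-const n (+ s₀))
          (ℤP.*-cancelʳ-≡ _ _ (+ G) (begin
            + n * + s₀ * + G         ≡⟨ ℤP.*-assoc (+ n) (+ s₀) (+ G) ⟩
            + n * (+ s₀ * + G)       ≡⟨ cong (+ n *_) Q≡s₀*G ⟨
            + n * + Q                ≡⟨ ℤP.*-comm (+ n) (+ Q) ⟩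
            + Q * + n                ≡⟨ M*p≡Q*n ⟨
            + M * + p                ≡⟨ cong (_* + p) M≡m*G ⟩
            m * + G * + p            ≡⟨ swap m (+ G) (+ p) ⟩
            m * + p * + G            ∎)))))
        where
        open ≡-Reasoning
        instance _ = ℕ.>-nonZero 1≤G
        swap : ∀ a b c → a * b * c ≡ a * c * b
        swap = solve-∀

open import Data.Nat using (ℕ; _≤_; _*_)
open import Data.Nat.Divisibility using (_∣_)
open import Data.Nat.GCD using (gcd)
open import Data.Integer as ℤ using (ℤ; +_; ∣_∣)
open import Data.Integer.Divisibility using () renaming (_∣_ to _∣ℤ_)
open import Data.Product using (Σ; _×_; ∃)
open import Function.Bundles using (_⇔_)
open import Relation.Binary.PropositionalEquality using (_≡_)

open import Data.Nat using (s≤s)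
open import Function.Bundles using (mk⇔)

proposition9p1 : (r p q n : ℕ) → 1 ≤ r → 1 ≤ p → 1 ≤ q → 3 ≤ n →
    p ∣ r → q ∣ r → (p * q) ∣ (r * n) →
    (j k i : ℤ) →
    (+ p) ∣ℤ ((+ n) ℤ.* i) →
    (cpow {n} i · cpow i) ∼[ r , q ] ε →
    (((g : Elt n) → InG p g → InG p (α p q n j k i g))
      × ((g h : Elt n) → InG p g → InG p h → g ≈[ r ] h → α p q n j k i g ∼[ r , q ] α p q n j k i h)
      × ((g h : Elt n) → InG p g → InG p h →
           α p q n j k i (g · h) ∼[ r , q ] (α p q n j k i g · α p q n j k i h))
      × ((m : ℤ) → α p q n j k i (cpow ((+ (r ÷ q)) ℤ.* m)) ∼[ r , q ] ε))
    × ((((g h : Elt n) → InG p g → InG p h → α p q n j k i g ∼[ r , q ] α p q n j k i h → g ∼[ r , q ] h)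
         × ((g : Elt n) → InG p g → ∃ λ (h : Elt n) → InG p h × (α p q n j k i h ∼[ r , q ] g)))
       ⇔ ((gcd ∣ j ∣ r ≡ 1)
          × (gcd (gcd ∣ (+ (n ÷ d₀ p q n)) ℤ.* k ℤ.+ j ∣ ((r * n) ÷ (p * q))) (r ÷ q) ≡ 1)))
proposition9p1 r p q n 1≤r 1≤p 1≤q (s≤s (s≤s (s≤s _))) p∣r q∣r pq∣rn j k i p∣ni z²≡1 =
  (φ-preserves-G p∣ni , φ-resp-≈ , φ-homomorphic (z²≡1⇒Q∣2i zero z²≡1) , φ-kills-C_q) ,
  mk⇔ (λ (inj , _) → injective⇒coprime-j refl 1≤r inj , injective⇒coprime-A zero 1≤r inj)
      (λ (coprime-j , coprime-A) → φ-injective coprime-j coprime-A zero , φ-surjective coprime-j coprime-A p∣ni)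
  where open Setting.Automorphism r p q n 1≤p 1≤q p∣r q∣r pq∣rn j k i
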